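{- Let $t<k$ be positive integers and let $2\le v_1\le v_2\le\cdots\le v_k$ be integers. Then $(\bar{1},t)\text{ -LAN}(k,(v_1,\dots,v_k))$ is at least: 1. $\prod_{i=k-t+1}^{k} v_i$, if $2v_{k-t}\le v_{k-t+1}$; 2. $\left\lceil \dfrac{2\sum_{i\le j_1<\cdots<j_t\le k}\prod_{s=1}^{t} v_{j_s}}{1+\binom{k-i+1}{t}}\right\rceil$, if $v_i=v_{i+1}=\cdots=v_{k-t}=v_{k-t+1}$ for some $i\in\{1,2,\dots,k-t\}$; 3. $\max\left\{\left\lceil \dfrac{2\sum_{k-t\le j_1<\cdots<j_t\le k}\prod_{s=1}^{t} v_{j_s}}{t+2}\right\rceil,\ \prod_{i=k-t+1}^{k} v_i+\prod_{i=k-t+2}^{k} v_i\right\}$, if $v_{k-t}<v_{k-t+1}<2v_{k-t}$ and $t\ge 2$; 4. $\left\lceil \dfrac{2v_{k-1}+2v_k}{3}\right\rceil$, if $v_{k-t}<v_{k-t+1}<2v_{k-t}$ and $t=1$.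
   Context: Let $k,t,N$ be positive integers with $t<k$. For positive integers $v_1,\dots,v_k$, consider $N\times k$ arrays $A=(a_{rj})$ whose $j$-th column has entries from a fixed set $V_j$ with $|V_j|=v_j$. A $t$-way interaction is a set $T=\{(j,\sigma_j): j\in I\}$ with $I\subseteq\{1,\dots,k\}$, $|I|=t$, $\sigma_j\in V_j$. Let $\rho(A,T)$ be the set of row indices $r$ with $a_{rj}=\sigma_j$ for all $j\in I$, and for a set $\mathcal T$ of $t$-way interactions let $\rho(A,\mathcal T)=\bigcup_{T\in\mathcal T}\rho(A,T)$. $A$ is a $(\bar 1,t)$-locating array, written $(\bar1,t)$-LA$(N;k,(v_1,\dots,v_k))$, if for all sets $\mathcal T_1,\mathcal T_2$ of $t$-way interactions with $|\mathcal T_1|\le1$, $|\mathcal T_2|\le1$ one has $\rho(A,\mathcal T_1)=\rho(A,\mathcal T_2)\iff \mathcal T_1=\mathcal T_2$ (equivalently: every $t$-way interaction occurs in at least one row, and distinct $t$-way interactions $T_1\neq T_2$ satisfy $\rho(A,T_1)\ne\rho(A,T_2)$). $(\bar1,t)$-LAN$(k,(v_1,\dots,v_k))$ denotes the minimum $N$ for which a $(\bar1,t)$-LA$(N;k,(v_1,\dots,v_k))$ exists. -}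

module Defs where

open import Data.Nat using (ℕ; zero; suc; _+_; _*_; _∸_; _/_; NonZero)
open import Data.Nat.DivMod
open import Data.List using (List; []; _∷_; map; upTo)
open import Data.Fin using (Fin; toℕ)
open import Data.Fin.Subset using (Subset; _∈_; ∣_∣)
open import Data.Product using (Σ; _×_; ∃; _,_)
open import Relation.Binary.PropositionalEquality using (_≡_)

range : ℕ → ℕ → List ℕ
range a b = map (a +_) (upTo (suc b ∸ a))

esym : List ℕ → ℕ → ℕ
esym xs zero = 1
esym [] (suc t) = 0
esym (x ∷ xs) (suc t) = x * esym xs t + esym xs (suc t)

ceilDiv : ℕ → (b : ℕ) → .{{_ : NonZero b}} → ℕ
ceilDiv a b = (a + (b ∸ 1)) / b

-- The alphabet sizes v are indexed 1..k as in the paper: column j : Fin k (0-based)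
-- has alphabet Fin (v (suc (toℕ j))).
Alph : (v : ℕ → ℕ) → {k : ℕ} → Fin k → Set
Alph v j = Fin (v (suc (toℕ j)))

Array : (N k : ℕ) → (v : ℕ → ℕ) → Set
Array N k v = Fin N → (j : Fin k) → Alph v j

-- A t-way interaction: a set I of t columns, and a value σ_j ∈ V_j for each column;
-- only the values on I are relevant (see ≈I below).
record Interaction (k t : ℕ) (v : ℕ → ℕ) : Set where
  constructor interaction
  field
    cols  : Subset k
    size  : ∣ cols ∣ ≡ t
    vals  : (j : Fin k) → Alph v j

open Interaction public

-- Equality of interactions as sets {(j, σ_j) : j ∈ I}.
_≈I_ : ∀ {k t v} → Interaction k t v → Interaction k t v → Set
T₁ ≈I T₂ = (cols T₁ ≡ cols T₂) × (∀ j → j ∈ cols T₁ → vals T₁ j ≡ vals T₂ j)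

covers : ∀ {N k t v} → Array N k v → Fin N → Interaction k t v → Set
covers A r T = ∀ j → j ∈ cols T → A r j ≡ vals T j

IsLocating1 : (N k t : ℕ) (v : ℕ → ℕ) → Array N k v → Set
IsLocating1 N k t v A =
  ((T : Interaction k t v) → ∃ λ r → covers A r T) ×
  ((T₁ T₂ : Interaction k t v) →
     (∀ r → (covers A r T₁ → covers A r T₂) × (covers A r T₂ → covers A r T₁)) →
     T₁ ≈I T₂)

module Submission where

-- Every bound is a counting argument on the rows of the array restricted to a suffix of its columns
-- (dropping columns keeps the array locating). Weigh each row r ∈ ρ(T) by 1, plus 1 when ρ(T) = {r}:
-- every t-way interaction T weighs at least 2, while a row lies in C(n, t) interactions and, since
-- distinct interactions have distinct ρ, is the only row of at most one of them. Hence
-- 2 Σ_{j₁<…<j_t} ∏ v_{j_s} ≤ N (1 + C(n, t)) on any n final columns, which gives cases 1, 2, 4 and the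
-- first bound of case 3. For the second bound of case 3 fix values σ on the last t − 1 columns: among
-- the rows agreeing with σ, the classes of column k − t and those of column k − t + 1 are the row sets
-- of distinct interactions, so no two coincide, and when v_{k−t+1} < 2 v_{k−t} this forces more than
-- v_{k−t+1} such rows.

open import Defs
open import Data.Nat using (ℕ; zero; suc; _+_; _*_; _∸_; _≤_; _<_; _⊔_; z≤n; s≤s; _≤?_)
open import Data.Nat.Properties hiding (_≟_)
open import Data.Nat.Combinatorics using (_C_; nCn≡1; nC1≡n; nCk≡nC[n∸k]; nCk+nC[k+1]≡[n+1]C[k+1])
open import Data.Nat.DivMod using (m<n*o⇒m/o<n)
open import Data.Nat.ListAction using (product)
open import Data.Bool using (true; false; if_then_else_)
open import Data.Fin using (Fin; zero; suc; toℕ; fromℕ<)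
open import Data.Fin.Properties using (_≟_; toℕ<n)
open import Data.Fin.Subset using (⊤) renaming (⊥ to ∅)
open import Data.Fin.Subset.Properties using (∈⊤; ∉⊥; ∣⊤∣≡n; ∣⊥∣≡0)
open import Data.Vec using ([]; _∷_)
open import Data.Vec.Properties using (∷-injective)
open import Data.Vec.Base using (here; there)
open import Data.List using (List; []; _∷_; length; map; filter; upTo; applyUpTo; allFin)
open import Data.List.Properties using (length-tabulate; map-∘)
open import Data.List.Membership.Propositional using (_∈_)
open import Data.List.Membership.Propositional.Properties using (∈-filter⁺; ∈-allFin)
open import Data.List.Relation.Unary.Any using (here; there)
open import Data.Product using (_×_; _,_; proj₁; proj₂; ∃; Σ)
open import Data.Sum using (_⊎_; inj₁; inj₂)
open import Function.Bundles using (_⇔_; mk⇔; Equivalence)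
open import Relation.Nullary using (¬_; does; yes; no; contradiction)
open import Relation.Binary.PropositionalEquality
open import Algebra.Properties.CommutativeSemigroup +-commutativeSemigroup using (interchange)
open import Algebra.Properties.CommutativeSemigroup *-commutativeSemigroup using (x∙yz≈y∙xz)

open Equivalence using (to; from)

module _ {X : Set} where

  sumList : List X → (X → ℕ) → ℕ
  sumList []       f = 0
  sumList (x ∷ xs) f = f x + sumList xs f

  sumList-mono : ∀ xs {f g : X → ℕ} → (∀ x → x ∈ xs → f x ≤ g x) → sumList xs f ≤ sumList xs g
  sumList-mono []       f≤g = z≤n
  sumList-mono (x ∷ xs) f≤g =
    +-mono-≤ (f≤g x (here refl)) (sumList-mono xs (λ y y∈xs → f≤g y (there y∈xs)))

  sumList-+ : ∀ xs (f g : X → ℕ) → sumList xs (λ x → f x + g x) ≡ sumList xs f + sumList xs g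
  sumList-+ []       f g = refl
  sumList-+ (x ∷ xs) f g = trans (cong (f x + g x +_) (sumList-+ xs f g)) (interchange (f x) (g x) _ _)

  sumList-const : ∀ xs c → sumList xs (λ _ → c) ≡ length xs * c
  sumList-const []       c = refl
  sumList-const (x ∷ xs) c = cong (c +_) (sumList-const xs c)

  sumList-1 : ∀ xs → sumList xs (λ _ → 1) ≡ length xs
  sumList-1 xs = trans (sumList-const xs 1) (*-identityʳ (length xs))

  ∈⇒1≤length : ∀ {x : X} {xs} → x ∈ xs → 1 ≤ length xs
  ∈⇒1≤length (here _)  = s≤s z≤n
  ∈⇒1≤length (there _) = s≤s z≤n

  length≤1⇒∈-unique : ∀ {x y : X} {xs} → length xs ≤ 1 → x ∈ xs → y ∈ xs → x ≡ y
  length≤1⇒∈-unique {xs = _ ∷ []}    _         (here refl) (here refl) = refl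
  length≤1⇒∈-unique {xs = _ ∷ _ ∷ _} (s≤s ()) _ _

1≤m+n⇒1≤m⊎1≤n : ∀ m {n} → 1 ≤ m + n → 1 ≤ m ⊎ 1 ≤ n
1≤m+n⇒1≤m⊎1≤n zero    1≤n = inj₂ 1≤n
1≤m+n⇒1≤m⊎1≤n (suc m) _   = inj₁ (s≤s z≤n)

m≤1∧n≤1⇒m+n≤1 : ∀ {m n} → m ≤ 1 → n ≤ 1 → ¬ (1 ≤ m × 1 ≤ n) → m + n ≤ 1
m≤1∧n≤1⇒m+n≤1 {zero}              _  n≤1 _    = n≤1
m≤1∧n≤1⇒m+n≤1 {suc zero} {zero}   _  _   _    = s≤s z≤n
m≤1∧n≤1⇒m+n≤1 {suc zero} {suc n}  _  _   both = contradiction (s≤s z≤n , s≤s z≤n) both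
m≤1∧n≤1⇒m+n≤1 {suc (suc m)} (s≤s ()) _ _

sumFin : (m : ℕ) → (Fin m → ℕ) → ℕ
sumFin zero    f = 0
sumFin (suc m) f = f zero + sumFin m (λ i → f (suc i))

sumFin-cong : ∀ m {f g : Fin m → ℕ} → (∀ i → f i ≡ g i) → sumFin m f ≡ sumFin m g
sumFin-cong zero    f≡g = refl
sumFin-cong (suc m) f≡g = cong₂ _+_ (f≡g zero) (sumFin-cong m (λ i → f≡g (suc i)))

sumFin-+ : ∀ m (f g : Fin m → ℕ) → sumFin m (λ i → f i + g i) ≡ sumFin m f + sumFin m g
sumFin-+ zero    f g = refl
sumFin-+ (suc m) f g =
  trans (cong (f zero + g zero +_) (sumFin-+ m (λ i → f (suc i)) (λ i → g (suc i))))
        (interchange (f zero) (g zero) _ _)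

sumFin-const : ∀ m c → sumFin m (λ _ → c) ≡ m * c
sumFin-const zero    c = refl
sumFin-const (suc m) c = cong (c +_) (sumFin-const m c)

sumFin-mono : ∀ m {f g : Fin m → ℕ} → (∀ i → f i ≤ g i) → sumFin m f ≤ sumFin m g
sumFin-mono zero    f≤g = z≤n
sumFin-mono (suc m) f≤g = +-mono-≤ (f≤g zero) (sumFin-mono m (λ i → f≤g (suc i)))

*≤sumFin : ∀ m c {f : Fin m → ℕ} → (∀ i → c ≤ f i) → m * c ≤ sumFin m f
*≤sumFin m c c≤f = subst (_≤ _) (sumFin-const m c) (sumFin-mono m c≤f)

sumFin-indicator : ∀ m (β : Fin m) (h : Fin m → ℕ) →
  sumFin m (λ α → if does (β ≟ α) then h α else 0) ≡ h β
sumFin-indicator (suc m) zero    h =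
  trans (cong (h zero +_) (trans (sumFin-const m 0) (*-zeroʳ m))) (+-identityʳ _)
sumFin-indicator (suc m) (suc β) h = sumFin-indicator m β (λ i → h (suc i))

sumFin≤m⇒≤1 : ∀ m (f : Fin m → ℕ) → sumFin m f ≤ m → (∀ i → 1 ≤ f i) → ∀ i → f i ≤ 1
sumFin≤m⇒≤1 (suc m) f Σf≤ 1≤f zero =
  +-cancelʳ-≤ m (f zero) 1 (≤-trans (+-monoʳ-≤ (f zero) m≤rest) Σf≤)
  where
  m≤rest : m ≤ sumFin m (λ i → f (suc i))
  m≤rest = subst (_≤ sumFin m (λ i → f (suc i))) (*-identityʳ m) (*≤sumFin m 1 (λ i → 1≤f (suc i)))
sumFin≤m⇒≤1 (suc m) f Σf≤ 1≤f (suc i) =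
  sumFin≤m⇒≤1 m (λ i → f (suc i)) (+-cancelˡ-≤ 1 _ m (≤-trans (+-monoˡ-≤ _ (1≤f zero)) Σf≤))
    (λ i → 1≤f (suc i)) i

module _ {X : Set} {m : ℕ} (f : X → Fin m) where

  fiber : Fin m → List X → List X
  fiber α = filter (λ x → f x ≟ α)

  ∈-fiber⁺ : ∀ {α x xs} → x ∈ xs → f x ≡ α → x ∈ fiber α xs
  ∈-fiber⁺ {α} = ∈-filter⁺ (λ x → f x ≟ α)

  sumList-fiber-∷ : ∀ α x xs (g : X → ℕ) →
    sumList (fiber α (x ∷ xs)) g ≡ (if does (f x ≟ α) then g x else 0) + sumList (fiber α xs) g
  sumList-fiber-∷ α x xs g with f x ≟ α
  ... | yes _ = refl
  ... | no  _ = refl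

  sumFin-sumList-fiber : ∀ (g : Fin m → X → ℕ) xs →
    sumFin m (λ α → sumList (fiber α xs) (g α)) ≡ sumList xs (λ x → g (f x) x)
  sumFin-sumList-fiber g []       = trans (sumFin-const m 0) (*-zeroʳ m)
  sumFin-sumList-fiber g (x ∷ xs) = begin
    sumFin m (λ α → sumList (fiber α (x ∷ xs)) (g α))
      ≡⟨ sumFin-cong m (λ α → sumList-fiber-∷ α x xs (g α)) ⟩
    sumFin m (λ α → (if does (f x ≟ α) then g α x else 0) + sumList (fiber α xs) (g α))
      ≡⟨ sumFin-+ m _ _ ⟩
    sumFin m (λ α → if does (f x ≟ α) then g α x else 0) + sumFin m (λ α → sumList (fiber α xs) (g α))
      ≡⟨ cong₂ _+_ (sumFin-indicator m (f x) (λ α → g α x)) (sumFin-sumList-fiber g xs) ⟩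
    g (f x) x + sumList xs (λ x → g (f x) x) ∎
    where open ≡-Reasoning

  sumFin-length-fiber : ∀ xs → sumFin m (λ α → length (fiber α xs)) ≡ length xs
  sumFin-length-fiber xs = begin
    sumFin m (λ α → length (fiber α xs))        ≡⟨ sumFin-cong m (λ α → sym (sumList-1 (fiber α xs))) ⟩
    sumFin m (λ α → sumList (fiber α xs) (λ _ → 1)) ≡⟨ sumFin-sumList-fiber (λ _ _ → 1) xs ⟩
    sumList xs (λ _ → 1)                          ≡⟨ sumList-1 xs ⟩
    length xs ∎
    where open ≡-Reasoning

-- If |xs| ≤ b, every g-fiber is a singleton, so no f-fiber can be one; hence |xs| ≥ 2a > b.
fibers-distinct⇒<length : ∀ {X : Set} a b (f : X → Fin a) (g : X → Fin b) (xs : List X) →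
  (∀ α → ∃ λ x → x ∈ xs × f x ≡ α) → (∀ β → ∃ λ x → x ∈ xs × g x ≡ β) →
  (∀ α β → ¬ (∀ x → x ∈ xs → (f x ≡ α) ⇔ (g x ≡ β))) → b < 2 * a → b < length xs
fibers-distinct⇒<length a b f g xs f-onto g-onto distinct b<2a with suc b ≤? length xs
... | yes b<len = b<len
... | no  b≮len = contradiction (≤-trans 2a≤len len≤b) (<⇒≱ b<2a)
  where
  len≤b : length xs ≤ b
  len≤b = ≮⇒≥ b≮len

  g-fiber≤1 : ∀ β → length (fiber g β xs) ≤ 1
  g-fiber≤1 = sumFin≤m⇒≤1 b (λ β → length (fiber g β xs))
    (≤-trans (≤-reflexive (sumFin-length-fiber g xs)) len≤b)
    (λ β → let (x , x∈xs , gx≡β) = g-onto β in ∈⇒1≤length (∈-fiber⁺ g x∈xs gx≡β))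

  2≤f-fiber : ∀ α → 2 ≤ length (fiber f α xs)
  2≤f-fiber α with 2 ≤? length (fiber f α xs) | f-onto α
  ... | yes 2≤ | _                    = 2≤
  ... | no  2≰ | x₀ , x₀∈xs , fx₀≡α = contradiction same-fibers (distinct α (g x₀))
    where
    same-fibers : ∀ x → x ∈ xs → (f x ≡ α) ⇔ (g x ≡ g x₀)
    same-fibers x x∈xs = mk⇔
      (λ fx≡α → cong g (length≤1⇒∈-unique (≮⇒≥ 2≰)
                  (∈-fiber⁺ f x∈xs fx≡α) (∈-fiber⁺ f x₀∈xs fx₀≡α)))
      (λ gx≡gx₀ → trans (cong f (length≤1⇒∈-unique (g-fiber≤1 (g x₀))
                    (∈-fiber⁺ g x∈xs gx≡gx₀) (∈-fiber⁺ g x₀∈xs refl))) fx₀≡α)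

  2a≤len : 2 * a ≤ length xs
  2a≤len = begin
    2 * a                                   ≡⟨ *-comm 2 a ⟩
    a * 2                                   ≤⟨ *≤sumFin a 2 2≤f-fiber ⟩
    sumFin a (λ α → length (fiber f α xs))  ≡⟨ sumFin-length-fiber f xs ⟩
    length xs ∎
    where open ≤-Reasoning

shift : (ℕ → ℕ) → ℕ → ℕ
shift v m = v (suc m)

shiftBy : ℕ → (ℕ → ℕ) → ℕ → ℕ
shiftBy d v m = v (d + m)

alphabetSizes : (ℕ → ℕ) → ℕ → List ℕ
alphabetSizes v zero    = []
alphabetSizes v (suc k) = v 1 ∷ alphabetSizes (shift v) k

Assignment : (ℕ → ℕ) → ℕ → Set
Assignment v k = (j : Fin k) → Alph v j

prepend : ∀ {k} v → Fin (v 1) → Assignment (shift v) k → Assignment v (suc k)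
prepend v α σ zero    = α
prepend v α σ (suc j) = σ j

module _ {N k : ℕ} (v : ℕ → ℕ) (A : Array N (suc k) v) where

  headColumn : Fin N → Fin (v 1)
  headColumn r = A r zero

  tailColumns : Array N k (shift v)
  tailColumns r j = A r (suc j)

-- covers and ≈I ignore the value on an unselected column; withoutHead puts the dummy x there.
withHead : ∀ {k t} v → Fin (v 1) → Interaction k t (shift v) → Interaction (suc k) (suc t) v
withHead v α T = interaction (true ∷ cols T) (cong suc (size T)) (prepend v α (vals T))

withoutHead : ∀ {k t} v → Fin (v 1) → Interaction k t (shift v) → Interaction (suc k) t v
withoutHead v x T = interaction (false ∷ cols T) (size T) (prepend v x (vals T))

module _ {N k t : ℕ} (v : ℕ → ℕ) (A : Array N (suc k) v) (r : Fin N) (T : Interaction k t (shift v)) where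

  covers-withHead : ∀ α →
    covers A r (withHead v α T) ⇔ (headColumn v A r ≡ α × covers (tailColumns v A) r T)
  covers-withHead α = mk⇔
    (λ c → c zero here , λ j j∈T → c (suc j) (there j∈T))
    (λ { (e , c) zero here → e ; (e , c) (suc j) (there j∈T) → c j j∈T })

  covers-withoutHead : ∀ x → covers A r (withoutHead v x T) ⇔ covers (tailColumns v A) r T
  covers-withoutHead x = mk⇔
    (λ c j j∈T → c (suc j) (there j∈T))
    (λ { c zero () ; c (suc j) (there j∈T) → c j j∈T })

module _ {k t : ℕ} (v : ℕ → ℕ) where

  withHead-injective : ∀ {α β} (T₁ T₂ : Interaction k t (shift v)) →
    withHead v α T₁ ≈I withHead v β T₂ → T₁ ≈I T₂
  withHead-injective T₁ T₂ (same-cols , same-vals) =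
    proj₂ (∷-injective same-cols) , λ j j∈T₁ → same-vals (suc j) (there j∈T₁)

  withoutHead-injective : ∀ {x y} (T₁ T₂ : Interaction k t (shift v)) →
    withoutHead v x T₁ ≈I withoutHead v y T₂ → T₁ ≈I T₂
  withoutHead-injective T₁ T₂ (same-cols , same-vals) =
    proj₂ (∷-injective same-cols) , λ j j∈T₁ → same-vals (suc j) (there j∈T₁)

  withHead≉withoutHead : ∀ {α x} (T₁ : Interaction k t (shift v)) (T₂ : Interaction k (suc t) (shift v)) →
    ¬ (withHead v α T₁ ≈I withoutHead v x T₂)
  withHead≉withoutHead T₁ T₂ (same-cols , _) with proj₁ (∷-injective same-cols)
  ... | ()

Covering : ∀ {N k} t v → Array N k v → List (Fin N) → Set
Covering {k = k} t v A R = (T : Interaction k t v) → ∃ λ r → r ∈ R × covers A r T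

Separating : ∀ {N k} t v → Array N k v → List (Fin N) → Set
Separating {k = k} t v A R =
  (T₁ T₂ : Interaction k t v) → (∀ r → r ∈ R → covers A r T₁ ⇔ covers A r T₂) → T₁ ≈I T₂

IsLocating1⇒allFin : ∀ {N k t v} (A : Array N k v) → IsLocating1 N k t v A →
  Covering t v A (allFin N) × Separating t v A (allFin N)
IsLocating1⇒allFin A (cov , sep) =
  (λ T → let (r , c) = cov T in r , ∈-allFin r , c) ,
  (λ T₁ T₂ same → sep T₁ T₂ (λ r → let e = same r (∈-allFin r) in to e , from e))

module _ {N k t : ℕ} (v : ℕ → ℕ) (A : Array N (suc k) v) (R : List (Fin N)) where

  private
    B = tailColumns v A
    rowsWith : Fin (v 1) → List (Fin N)
    rowsWith α = fiber (headColumn v A) α R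

  Covering-tail : Fin (v 1) → Covering t v A R → Covering t (shift v) B R
  Covering-tail x cov T =
    let (r , r∈R , c) = cov (withoutHead v x T) in r , r∈R , to (covers-withoutHead v A r T x) c

  Covering-fiber : Covering (suc t) v A R → ∀ α → Covering t (shift v) B (rowsWith α)
  Covering-fiber cov α T =
    let (r , r∈R , c) = cov (withHead v α T)
        (e , c′)      = to (covers-withHead v A r T α) c
    in r , ∈-fiber⁺ (headColumn v A) r∈R e , c′

  Separating-tail : Fin (v 1) → Separating t v A R → Separating t (shift v) B R
  Separating-tail x sep T₁ T₂ same =
    withoutHead-injective v T₁ T₂ (sep (withoutHead v x T₁) (withoutHead v x T₂) same′)
    where
    same′ : ∀ r → r ∈ R → covers A r (withoutHead v x T₁) ⇔ covers A r (withoutHead v x T₂)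
    same′ r r∈R = mk⇔
      (λ c → from (covers-withoutHead v A r T₂ x) (to (same r r∈R) (to (covers-withoutHead v A r T₁ x) c)))
      (λ c → from (covers-withoutHead v A r T₁ x) (from (same r r∈R) (to (covers-withoutHead v A r T₂ x) c)))

  Separating-fiber : Separating (suc t) v A R → ∀ α → Separating t (shift v) B (rowsWith α)
  Separating-fiber sep α T₁ T₂ same =
    withHead-injective v T₁ T₂ (sep (withHead v α T₁) (withHead v α T₂) same′)
    where
    transport : ∀ r → r ∈ R → ∀ {T T′} → (∀ r → r ∈ rowsWith α → covers B r T → covers B r T′) →
      covers A r (withHead v α T) → covers A r (withHead v α T′)
    transport r r∈R {T} {T′} T⇒T′ c =
      let (e , c′) = to (covers-withHead v A r T α) c
      in from (covers-withHead v A r T′ α) (e , T⇒T′ r (∈-fiber⁺ (headColumn v A) r∈R e) c′)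

    same′ : ∀ r → r ∈ R → covers A r (withHead v α T₁) ⇔ covers A r (withHead v α T₂)
    same′ r r∈R = mk⇔ (transport r r∈R {T₁} {T₂} (λ r r∈ → to (same r r∈)))
                      (transport r r∈R {T₂} {T₁} (λ r r∈ → from (same r r∈)))

dropColumns : ∀ {N n} d v → Array N (d + n) v → Array N n (shiftBy d v)
dropColumns zero    v A = A
dropColumns (suc d) v A = dropColumns d (shift v) (tailColumns v A)

dropAssignment : ∀ {n} d v → Assignment v (d + n) → Assignment (shiftBy d v) n
dropAssignment zero    v σ = σ
dropAssignment (suc d) v σ = dropAssignment d (shift v) (λ j → σ (suc j))

module _ {N n t : ℕ} (R : List (Fin N)) where

  Covering-drop : ∀ d v (A : Array N (d + n) v) → Assignment v (d + n) →
    Covering t v A R → Covering t (shiftBy d v) (dropColumns d v A) R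
  Covering-drop zero    v A σ cov = cov
  Covering-drop (suc d) v A σ cov =
    Covering-drop d (shift v) (tailColumns v A) (λ j → σ (suc j)) (Covering-tail v A R (σ zero) cov)

  Separating-drop : ∀ d v (A : Array N (d + n) v) → Assignment v (d + n) →
    Separating t v A R → Separating t (shiftBy d v) (dropColumns d v A) R
  Separating-drop zero    v A σ sep = sep
  Separating-drop (suc d) v A σ sep =
    Separating-drop d (shift v) (tailColumns v A) (λ j → σ (suc j)) (Separating-tail v A R (σ zero) sep)

-- Double counting

isSingleton : ∀ {X : Set} → List X → ℕ
isSingleton (_ ∷ []) = 1
isSingleton _        = 0

module _ {X : Set} where

  isSingleton≤1 : (xs : List X) → isSingleton xs ≤ 1
  isSingleton≤1 []          = z≤n
  isSingleton≤1 (_ ∷ [])    = s≤s z≤n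
  isSingleton≤1 (_ ∷ _ ∷ _) = z≤n

  isSingleton⇒length≤1 : (xs : List X) → 1 ≤ isSingleton xs → length xs ≤ 1
  isSingleton⇒length≤1 (_ ∷ []) _ = s≤s z≤n

  2≤length*[1+isSingleton] : ∀ {x} (xs : List X) → x ∈ xs → 2 ≤ length xs * (1 + isSingleton xs)
  2≤length*[1+isSingleton] (_ ∷ [])    _ = s≤s (s≤s z≤n)
  2≤length*[1+isSingleton] (_ ∷ _ ∷ xs) _ =
    subst (2 ≤_) (sym (*-identityʳ (2 + length xs))) (s≤s (s≤s z≤n))

module _ {N : ℕ} where

  -- Σ over t-way interactions T of φ(ρ_R(T)), the rows of R covering T.
  interactionSum : ∀ (k t : ℕ) v → Array N k v → (List (Fin N) → ℕ) → List (Fin N) → ℕ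
  interactionSum k       zero    v A φ R = φ R
  interactionSum zero    (suc t) v A φ R = 0
  interactionSum (suc k) (suc t) v A φ R =
    sumFin (v 1) (λ α → interactionSum k t (shift v) (tailColumns v A) φ (fiber (headColumn v A) α R))
    + interactionSum k (suc t) (shift v) (tailColumns v A) φ R

  -- Σ over t-sets I of columns of ψ applied to the rows of R that agree with row r on I.
  agreementSum : ∀ (k t : ℕ) v → Array N k v → (List (Fin N) → ℕ) → Fin N → List (Fin N) → ℕ
  agreementSum k       zero    v A ψ r R = ψ R
  agreementSum zero    (suc t) v A ψ r R = 0
  agreementSum (suc k) (suc t) v A ψ r R =
    agreementSum k t (shift v) (tailColumns v A) ψ r (fiber (headColumn v A) (A r zero) R)
    + agreementSum k (suc t) (shift v) (tailColumns v A) ψ r R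

  interactionSum≡sumList-agreementSum : ∀ (k t : ℕ) v A ψ R →
    interactionSum k t v A (λ L → sumList L (λ _ → ψ L)) R ≡ sumList R (λ r → agreementSum k t v A ψ r R)
  interactionSum≡sumList-agreementSum k       zero    v A ψ R = refl
  interactionSum≡sumList-agreementSum zero    (suc t) v A ψ R =
    sym (trans (sumList-const R 0) (*-zeroʳ (length R)))
  interactionSum≡sumList-agreementSum (suc k) (suc t) v A ψ R = begin
    sumFin (v 1) (λ α → interactionSum k t (shift v) B φ (fiber f α R))
      + interactionSum k (suc t) (shift v) B φ R
      ≡⟨ cong₂ _+_
           (sumFin-cong (v 1) (λ α → interactionSum≡sumList-agreementSum k t (shift v) B ψ (fiber f α R)))
           (interactionSum≡sumList-agreementSum k (suc t) (shift v) B ψ R) ⟩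
    sumFin (v 1) (λ α → sumList (fiber f α R) (λ r → agreementSum k t (shift v) B ψ r (fiber f α R))) + skipped
      ≡⟨ cong (_+ skipped) (sumFin-sumList-fiber f (λ α r → agreementSum k t (shift v) B ψ r (fiber f α R)) R) ⟩
    sumList R (λ r → agreementSum k t (shift v) B ψ r (fiber f (f r) R)) + skipped
      ≡⟨ sumList-+ R _ _ ⟨
    sumList R (λ r → agreementSum (suc k) (suc t) v A ψ r R) ∎
    where
    open ≡-Reasoning
    B = tailColumns v A
    f = headColumn v A
    φ = λ L → sumList L (λ _ → ψ L)
    skipped = sumList R (λ r → agreementSum k (suc t) (shift v) B ψ r R)

  agreementSum-1 : ∀ (k t : ℕ) v A r R → agreementSum k t v A (λ _ → 1) r R ≡ k C t
  agreementSum-1 k       zero    v A r R = refl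
  agreementSum-1 zero    (suc t) v A r R = refl
  agreementSum-1 (suc k) (suc t) v A r R =
    trans (cong₂ _+_ (agreementSum-1 k t (shift v) (tailColumns v A) r _)
                     (agreementSum-1 k (suc t) (shift v) (tailColumns v A) r R))
          (nCk+nC[k+1]≡[n+1]C[k+1] k t)

  agreementSum-+ : ∀ (k t : ℕ) v A ψ₁ ψ₂ r R →
    agreementSum k t v A (λ L → ψ₁ L + ψ₂ L) r R
      ≡ agreementSum k t v A ψ₁ r R + agreementSum k t v A ψ₂ r R
  agreementSum-+ k       zero    v A ψ₁ ψ₂ r R = refl
  agreementSum-+ zero    (suc t) v A ψ₁ ψ₂ r R = refl
  agreementSum-+ (suc k) (suc t) v A ψ₁ ψ₂ r R =
    trans (cong₂ _+_ (agreementSum-+ k t (shift v) B ψ₁ ψ₂ r R′)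
                     (agreementSum-+ k (suc t) (shift v) B ψ₁ ψ₂ r R))
          (interchange (agreementSum k t (shift v) B ψ₁ r R′) (agreementSum k t (shift v) B ψ₂ r R′) _ _)
    where
    B = tailColumns v A
    R′ = fiber (headColumn v A) (A r zero) R

  emptyInteraction : ∀ {k v} → Assignment v k → Interaction k 0 v
  emptyInteraction {k} σ = interaction ∅ (∣⊥∣≡0 k) σ

  CoveredOnlyBy : ∀ {k t v} → Array N k v → List (Fin N) → Fin N → Interaction k t v → Set
  CoveredOnlyBy A R r T = covers A r T × (∀ r′ → r′ ∈ R → covers A r′ T → r′ ≡ r)

  module _ {k t : ℕ} (v : ℕ → ℕ) (A : Array N (suc k) v) (R : List (Fin N)) (r : Fin N)
           (T : Interaction k t (shift v)) where

    CoveredOnlyBy-withHead : CoveredOnlyBy (tailColumns v A) (fiber (headColumn v A) (A r zero) R) r T →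
      CoveredOnlyBy A R r (withHead v (A r zero) T)
    CoveredOnlyBy-withHead (c , only) =
      from (covers-withHead v A r T (A r zero)) (refl , c) ,
      λ r′ r′∈R c′ → let (e , c″) = to (covers-withHead v A r′ T (A r zero)) c′
                     in only r′ (∈-fiber⁺ (headColumn v A) r′∈R e) c″

    CoveredOnlyBy-withoutHead : ∀ x →
      CoveredOnlyBy (tailColumns v A) R r T → CoveredOnlyBy A R r (withoutHead v x T)
    CoveredOnlyBy-withoutHead x (c , only) =
      from (covers-withoutHead v A r T x) c ,
      λ r′ r′∈R c′ → only r′ r′∈R (to (covers-withoutHead v A r′ T x) c′)

  CoveredOnlyBy⇒same-rows : ∀ {k t v} (A : Array N k v) R r (T₁ T₂ : Interaction k t v) →
    CoveredOnlyBy A R r T₁ → CoveredOnlyBy A R r T₂ →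
    ∀ r′ → r′ ∈ R → covers A r′ T₁ ⇔ covers A r′ T₂
  CoveredOnlyBy⇒same-rows A R r T₁ T₂ (c₁ , only₁) (c₂ , only₂) r′ r′∈R = mk⇔
    (λ c → subst (λ s → covers A s T₂) (sym (only₁ r′ r′∈R c)) c₂)
    (λ c → subst (λ s → covers A s T₁) (sym (only₂ r′ r′∈R c)) c₁)

  isolating-interaction : ∀ (k t : ℕ) v (A : Array N k v) R r → r ∈ R → Assignment v k →
    1 ≤ agreementSum k t v A isSingleton r R → Σ (Interaction k t v) (CoveredOnlyBy A R r)
  isolating-interaction k zero v A R r r∈R σ single =
    emptyInteraction σ , (λ j j∈∅ → contradiction j∈∅ ∉⊥) ,
    λ r′ r′∈R _ → length≤1⇒∈-unique (isSingleton⇒length≤1 R single) r′∈R r∈R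
  isolating-interaction zero (suc t) v A R r r∈R σ ()
  isolating-interaction (suc k) (suc t) v A R r r∈R σ single
    with 1≤m+n⇒1≤m⊎1≤n _ single
  ... | inj₁ head-chosen =
    let (T , only) = isolating-interaction k t (shift v) (tailColumns v A) (fiber (headColumn v A) (A r zero) R) r
                       (∈-fiber⁺ (headColumn v A) r∈R refl) (λ j → σ (suc j)) head-chosen
    in withHead v (A r zero) T , CoveredOnlyBy-withHead v A R r T only
  ... | inj₂ head-skipped =
    let (T , only) = isolating-interaction k (suc t) (shift v) (tailColumns v A) R r r∈R (λ j → σ (suc j))
                       head-skipped
    in withoutHead v (σ zero) T , CoveredOnlyBy-withoutHead v A R r T (σ zero) only

  -- Two distinct column sets both isolating r would give two distinct interactions with ρ = {r}.
  agreementSum-isSingleton≤1 : ∀ (k t : ℕ) v (A : Array N k v) R r → r ∈ R → Assignment v k →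
    Separating t v A R → agreementSum k t v A isSingleton r R ≤ 1
  agreementSum-isSingleton≤1 k       zero    v A R r r∈R σ sep = isSingleton≤1 R
  agreementSum-isSingleton≤1 zero    (suc t) v A R r r∈R σ sep = z≤n
  agreementSum-isSingleton≤1 (suc k) (suc t) v A R r r∈R σ sep =
    m≤1∧n≤1⇒m+n≤1
      (agreementSum-isSingleton≤1 k t (shift v) B R′ r r∈R′ σ′ (Separating-fiber v A R sep (A r zero)))
      (agreementSum-isSingleton≤1 k (suc t) (shift v) B R r r∈R σ′ (Separating-tail v A R (σ zero) sep))
      not-both
    where
    B = tailColumns v A
    R′ = fiber (headColumn v A) (A r zero) R
    r∈R′ = ∈-fiber⁺ (headColumn v A) r∈R refl
    σ′ : Assignment (shift v) k
    σ′ j = σ (suc j)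
    not-both : ¬ (1 ≤ agreementSum k t (shift v) B isSingleton r R′
                × 1 ≤ agreementSum k (suc t) (shift v) B isSingleton r R)
    not-both (chosen , skipped) =
      let (T₁ , only₁) = isolating-interaction k t (shift v) B R′ r r∈R′ σ′ chosen
          (T₂ , only₂) = isolating-interaction k (suc t) (shift v) B R r r∈R σ′ skipped
          U₁ = withHead v (A r zero) T₁
          U₂ = withoutHead v (σ zero) T₂
      in withHead≉withoutHead v T₁ T₂ (sep U₁ U₂ (CoveredOnlyBy⇒same-rows A R r U₁ U₂
           (CoveredOnlyBy-withHead v A R r T₁ only₁) (CoveredOnlyBy-withoutHead v A R r T₂ (σ zero) only₂)))

  interactionSum-lowerBound : ∀ (k t : ℕ) v (A : Array N k v) R c φ → (∀ L {x} → x ∈ L → c ≤ φ L) →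
    Assignment v k → Covering t v A R → c * esym (alphabetSizes v k) t ≤ interactionSum k t v A φ R
  interactionSum-lowerBound k zero v A R c φ c≤φ σ cov =
    let (r , r∈R , _) = cov (emptyInteraction σ) in subst (_≤ φ R) (sym (*-identityʳ c)) (c≤φ R r∈R)
  interactionSum-lowerBound zero (suc t) v A R c φ c≤φ σ cov = ≤-reflexive (*-zeroʳ c)
  interactionSum-lowerBound (suc k) (suc t) v A R c φ c≤φ σ cov = begin
    c * (v 1 * e₀ + e₁)                  ≡⟨ *-distribˡ-+ c (v 1 * e₀) e₁ ⟩
    c * (v 1 * e₀) + c * e₁              ≡⟨ cong (_+ c * e₁) (x∙yz≈y∙xz c (v 1) e₀) ⟩
    v 1 * (c * e₀) + c * e₁
      ≤⟨ +-mono-≤ (*≤sumFin (v 1) (c * e₀) (λ α → interactionSum-lowerBound k t (shift v) B _ c φ c≤φ σ′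
                                                     (Covering-fiber v A R cov α)))
                  (interactionSum-lowerBound k (suc t) (shift v) B R c φ c≤φ σ′
                     (Covering-tail v A R (σ zero) cov)) ⟩
    interactionSum (suc k) (suc t) v A φ R ∎
    where
    open ≤-Reasoning
    B = tailColumns v A
    e₀ = esym (alphabetSizes (shift v) k) t
    e₁ = esym (alphabetSizes (shift v) k) (suc t)
    σ′ : Assignment (shift v) k
    σ′ j = σ (suc j)

  separating-bound : ∀ (k t : ℕ) v (A : Array N k v) R → Assignment v k →
    Covering t v A R → Separating t v A R → 2 * esym (alphabetSizes v k) t ≤ length R * (1 + k C t)
  separating-bound k t v A R σ cov sep = begin
    2 * esym (alphabetSizes v k) t                ≤⟨ interactionSum-lowerBound k t v A R 2 φ 2≤φ σ cov ⟩
    interactionSum k t v A φ R                    ≡⟨ interactionSum≡sumList-agreementSum k t v A ψ R ⟩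
    sumList R (λ r → agreementSum k t v A ψ r R) ≤⟨ sumList-mono R row-weight≤ ⟩
    sumList R (λ _ → 1 + k C t)                   ≡⟨ sumList-const R (1 + k C t) ⟩
    length R * (1 + k C t)                        ∎
    where
    open ≤-Reasoning
    ψ : List (Fin N) → ℕ
    ψ L = 1 + isSingleton L
    φ : List (Fin N) → ℕ
    φ L = sumList L (λ _ → ψ L)

    2≤φ : ∀ L {x} → x ∈ L → 2 ≤ φ L
    2≤φ L x∈L = subst (2 ≤_) (sym (sumList-const L (ψ L))) (2≤length*[1+isSingleton] L x∈L)

    row-weight≤ : ∀ r → r ∈ R → agreementSum k t v A ψ r R ≤ 1 + k C t
    row-weight≤ r r∈R = begin
      agreementSum k t v A ψ r R
        ≡⟨ agreementSum-+ k t v A (λ _ → 1) isSingleton r R ⟩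
      agreementSum k t v A (λ _ → 1) r R + agreementSum k t v A isSingleton r R
        ≡⟨ cong (_+ agreementSum k t v A isSingleton r R) (agreementSum-1 k t v A r R) ⟩
      k C t + agreementSum k t v A isSingleton r R
        ≤⟨ +-monoʳ-≤ (k C t) (agreementSum-isSingleton≤1 k t v A R r r∈R σ sep) ⟩
      k C t + 1
        ≡⟨ +-comm (k C t) 1 ⟩
      1 + k C t ∎

  -- Two columns with close alphabet sizes

  rowsAgreeing : ∀ m w → Array N m w → Assignment w m → List (Fin N) → List (Fin N)
  rowsAgreeing zero    w B σ R = R
  rowsAgreeing (suc m) w B σ R =
    rowsAgreeing m (shift w) (tailColumns w B) (λ j → σ (suc j)) (fiber (headColumn w B) (σ zero) R)

  ∈-rowsAgreeing⁺ : ∀ m w (B : Array N m w) σ {R r} → r ∈ R → (∀ j → B r j ≡ σ j) →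
    r ∈ rowsAgreeing m w B σ R
  ∈-rowsAgreeing⁺ zero    w B σ r∈R agree = r∈R
  ∈-rowsAgreeing⁺ (suc m) w B σ r∈R agree =
    ∈-rowsAgreeing⁺ m (shift w) (tailColumns w B) (λ j → σ (suc j))
      (∈-fiber⁺ (headColumn w B) r∈R (agree zero)) (λ j → agree (suc j))

  *product≤length : ∀ m w (B : Array N m w) R c →
    (∀ σ → c ≤ length (rowsAgreeing m w B σ R)) → c * product (alphabetSizes w m) ≤ length R
  *product≤length zero    w B R c big = subst (_≤ length R) (sym (*-identityʳ c)) (big (λ ()))
  *product≤length (suc m) w B R c big = begin
    c * (w 1 * P)                                   ≡⟨ x∙yz≈y∙xz c (w 1) P ⟩
    w 1 * (c * P)                                   ≤⟨ *≤sumFin (w 1) (c * P) class-bound ⟩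
    sumFin (w 1) (λ γ → length (fiber f γ R))       ≡⟨ sumFin-length-fiber f R ⟩
    length R                                        ∎
    where
    open ≤-Reasoning
    P = product (alphabetSizes (shift w) m)
    f = headColumn w B
    class-bound : ∀ γ → c * P ≤ length (fiber f γ R)
    class-bound γ =
      *product≤length m (shift w) (tailColumns w B) (fiber f γ R) c (λ σ → big (prepend w γ σ))

  module _ (m : ℕ) (v : ℕ → ℕ) (A : Array N (suc (suc m)) v) where

    private
      col₁ : Fin N → Fin (v 1)
      col₁ = headColumn v A
      col₂ : Fin N → Fin (v 2)
      col₂ = headColumn (shift v) (tailColumns v A)
      Last : Array N m (shift (shift v))
      Last = tailColumns (shift v) (tailColumns v A)

      full : Assignment (shift (shift v)) m → Interaction m m (shift (shift v))
      full σ = interaction ⊤ (∣⊤∣≡n m) σ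

      covers-full : ∀ r σ → covers Last r (full σ) ⇔ (∀ j → Last r j ≡ σ j)
      covers-full r σ = mk⇔ (λ c j → c j ∈⊤) (λ agree j _ → agree j)

    firstWithLast : Fin (v 1) → Fin (v 2) → Assignment (shift (shift v)) m → Interaction (suc (suc m)) (suc m) v
    firstWithLast α x σ = withHead v α (withoutHead (shift v) x (full σ))

    secondWithLast : Fin (v 1) → Fin (v 2) → Assignment (shift (shift v)) m → Interaction (suc (suc m)) (suc m) v
    secondWithLast y β σ = withoutHead v y (withHead (shift v) β (full σ))

    covers-firstWithLast : ∀ r α x σ →
      covers A r (firstWithLast α x σ) ⇔ (col₁ r ≡ α × (∀ j → Last r j ≡ σ j))
    covers-firstWithLast r α x σ = mk⇔
      (λ c → let (e , c′) = to (covers-withHead v A r (withoutHead (shift v) x (full σ)) α) c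
             in e , to (covers-full r σ) (to (covers-withoutHead (shift v) (tailColumns v A) r (full σ) x) c′))
      (λ (e , agree) → from (covers-withHead v A r (withoutHead (shift v) x (full σ)) α)
             (e , from (covers-withoutHead (shift v) (tailColumns v A) r (full σ) x) (from (covers-full r σ) agree)))

    covers-secondWithLast : ∀ r y β σ →
      covers A r (secondWithLast y β σ) ⇔ (col₂ r ≡ β × (∀ j → Last r j ≡ σ j))
    covers-secondWithLast r y β σ = mk⇔
      (λ c → let (e , c′) = to (covers-withHead (shift v) (tailColumns v A) r (full σ) β)
                              (to (covers-withoutHead v A r (withHead (shift v) β (full σ)) y) c)
             in e , to (covers-full r σ) c′)
      (λ (e , agree) → from (covers-withoutHead v A r (withHead (shift v) β (full σ)) y)
             (from (covers-withHead (shift v) (tailColumns v A) r (full σ) β) (e , from (covers-full r σ) agree)))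

    nearlyEqual-bound : ∀ R → Assignment v (suc (suc m)) → Covering (suc m) v A R → Separating (suc m) v A R →
      v 2 < 2 * v 1 →
      product (alphabetSizes (shift v) (suc m)) + product (alphabetSizes (shift (shift v)) m) ≤ length R
    nearlyEqual-bound R τ cov sep v₂<2v₁ =
      subst (_≤ length R) (+-comm P (v 2 * P)) (*product≤length m (shift (shift v)) Last R (suc (v 2)) class-bound)
      where
      P = product (alphabetSizes (shift (shift v)) m)
      y = τ zero
      x = τ (suc zero)

      class-bound : ∀ σ → suc (v 2) ≤ length (rowsAgreeing m (shift (shift v)) Last σ R)
      class-bound σ = fibers-distinct⇒<length (v 1) (v 2) col₁ col₂ Rσ col₁-onto col₂-onto distinct v₂<2v₁
        where
        Rσ = rowsAgreeing m (shift (shift v)) Last σ R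

        col₁-onto : ∀ α → ∃ λ r → r ∈ Rσ × col₁ r ≡ α
        col₁-onto α = let (r , r∈R , c) = cov (firstWithLast α x σ)
                          (e , agree)  = to (covers-firstWithLast r α x σ) c
                      in r , ∈-rowsAgreeing⁺ m (shift (shift v)) Last σ r∈R agree , e

        col₂-onto : ∀ β → ∃ λ r → r ∈ Rσ × col₂ r ≡ β
        col₂-onto β = let (r , r∈R , c) = cov (secondWithLast y β σ)
                          (e , agree)  = to (covers-secondWithLast r y β σ) c
                      in r , ∈-rowsAgreeing⁺ m (shift (shift v)) Last σ r∈R agree , e

        distinct : ∀ α β → ¬ (∀ r → r ∈ Rσ → (col₁ r ≡ α) ⇔ (col₂ r ≡ β))
        distinct α β same = withHead≉withoutHead v {α} {y}
          (withoutHead (shift v) x (full σ)) (withHead (shift v) β (full σ))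
          (sep (firstWithLast α x σ) (secondWithLast y β σ) λ r r∈R → mk⇔
            (λ c → let (e , agree) = to (covers-firstWithLast r α x σ) c
                   in from (covers-secondWithLast r y β σ)
                        (to (same r (∈-rowsAgreeing⁺ m (shift (shift v)) Last σ r∈R agree)) e , agree))
            (λ c → let (e , agree) = to (covers-secondWithLast r y β σ) c
                   in from (covers-firstWithLast r α x σ)
                        (from (same r (∈-rowsAgreeing⁺ m (shift (shift v)) Last σ r∈R agree)) e , agree)))

ceilDiv≤ : ∀ a b n → a ≤ n * suc b → ceilDiv a (suc b) ≤ n
ceilDiv≤ a b n a≤n*[1+b] = ≤-pred (m<n*o⇒m/o<n {a + b} {suc n} {suc b} a+b<[1+n]*[1+b])
  where
  a+b<[1+n]*[1+b] : a + b < suc n * suc b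
  a+b<[1+n]*[1+b] = subst (a + b <_) (+-comm (n * suc b) (suc b)) (+-mono-≤-< a≤n*[1+b] (n<1+n b))

esym-0 : ∀ xs t → length xs < t → esym xs t ≡ 0
esym-0 []       (suc t) _            = refl
esym-0 (x ∷ xs) (suc t) (s≤s len<t) = begin
  x * esym xs t + esym xs (suc t)
    ≡⟨ cong₂ (λ a b → x * a + b) (esym-0 xs t len<t) (esym-0 xs (suc t) (m<n⇒m<1+n len<t)) ⟩
  x * 0 + 0
    ≡⟨ cong (_+ 0) (*-zeroʳ x) ⟩
  0 ∎
  where open ≡-Reasoning

esym-length : ∀ xs → esym xs (length xs) ≡ product xs
esym-length []       = refl
esym-length (x ∷ xs) = begin
  x * esym xs (length xs) + esym xs (suc (length xs))
    ≡⟨ cong₂ (λ a b → x * a + b) (esym-length xs) (esym-0 xs _ (n<1+n _)) ⟩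
  x * product xs + 0
    ≡⟨ +-identityʳ _ ⟩
  product (x ∷ xs) ∎
  where open ≡-Reasoning

length-alphabetSizes : ∀ w n → length (alphabetSizes w n) ≡ n
length-alphabetSizes w zero    = refl
length-alphabetSizes w (suc n) = cong suc (length-alphabetSizes (shift w) n)

map-applyUpTo≡alphabetSizes : ∀ (g f : ℕ → ℕ) w n → (∀ j → g (f j) ≡ w (suc j)) →
  map g (applyUpTo f n) ≡ alphabetSizes w n
map-applyUpTo≡alphabetSizes g f w zero    g∘f≡w = refl
map-applyUpTo≡alphabetSizes g f w (suc n) g∘f≡w =
  cong₂ _∷_ (g∘f≡w 0)
    (map-applyUpTo≡alphabetSizes g (λ j → f (suc j)) (shift w) n (λ j → g∘f≡w (suc j)))

map-range≡alphabetSizes : ∀ v w d n {k} → d + n ≡ k → (∀ j → w j ≡ v (d + j)) →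
  map v (range (suc d) k) ≡ alphabetSizes w n
map-range≡alphabetSizes v w d n refl w≡v = begin
  map v (map (suc d +_) (upTo (d + n ∸ d)))
    ≡⟨ cong (λ m → map v (map (suc d +_) (upTo m))) (m+n∸m≡n d n) ⟩
  map v (map (suc d +_) (upTo n))
    ≡⟨ map-∘ (upTo n) ⟨
  map (λ j → v (suc d + j)) (upTo n)
    ≡⟨ map-applyUpTo≡alphabetSizes _ (λ j → j) w n (λ j → trans (cong v (sym (+-suc d j))) (sym (w≡v (suc j)))) ⟩
  alphabetSizes w n ∎
  where open ≡-Reasoning

esym-range-pair : ∀ v a → esym (map v (range a (suc a))) 1 ≡ v a + v (suc a)
esym-range-pair v a = begin
  esym (map v (map (a +_) (upTo (2 + a ∸ a)))) 1
    ≡⟨ cong (λ m → esym (map v (map (a +_) (upTo m))) 1) (m+n∸n≡m 2 a) ⟩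
  v (a + 0) * 1 + (v (a + 1) * 1 + 0)
    ≡⟨ cong₂ (λ x y → v x * 1 + (v y * 1 + 0)) (+-identityʳ a) (+-comm a 1) ⟩
  v a * 1 + (v (suc a) * 1 + 0)
    ≡⟨ cong₂ _+_ (*-identityʳ (v a)) (trans (+-identityʳ _) (*-identityʳ _)) ⟩
  v a + v (suc a) ∎
  where open ≡-Reasoning

[1+n]Cn≡1+n : ∀ n → suc n C n ≡ suc n
[1+n]Cn≡1+n n = begin
  suc n C n             ≡⟨ nCk≡nC[n∸k] (n≤1+n n) ⟩
  suc n C (suc n ∸ n)   ≡⟨ cong (suc n C_) (m+n∸n≡m 1 n) ⟩
  suc n C 1             ≡⟨ nC1≡n (suc n) ⟩
  suc n                 ∎
  where open ≡-Reasoning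

assignment : ∀ {k v} → (∀ i → 1 ≤ i → i ≤ k → 2 ≤ v i) → Assignment v k
assignment 2≤v j = fromℕ< (≤-trans (s≤s z≤n) (2≤v (suc (toℕ j)) (s≤s z≤n) (toℕ<n j)))

suffix-separating-bound : ∀ {N k t v} (A : Array N k v) → Assignment v k → IsLocating1 N k t v A →
  ∀ d n → d + n ≡ k → 2 * esym (map v (range (suc d) k)) t ≤ N * (1 + n C t)
suffix-separating-bound {N} {t = t} {v} A σ loc d n refl = begin
  2 * esym (map v (range (suc d) (d + n))) t
    ≡⟨ cong (λ xs → 2 * esym xs t) (map-range≡alphabetSizes v (shiftBy d v) d n refl (λ _ → refl)) ⟩
  2 * esym (alphabetSizes (shiftBy d v) n) t
    ≤⟨ separating-bound n t (shiftBy d v) (dropColumns d v A) (allFin N) (dropAssignment d v σ)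
         (Covering-drop (allFin N) d v A σ cov) (Separating-drop (allFin N) d v A σ sep) ⟩
  length (allFin N) * (1 + n C t)
    ≡⟨ cong (_* (1 + n C t)) (length-tabulate {n = N} (λ r → r)) ⟩
  N * (1 + n C t) ∎
  where
  open ≤-Reasoning
  cov = proj₁ (IsLocating1⇒allFin A loc)
  sep = proj₂ (IsLocating1⇒allFin A loc)

suffix-nearlyEqual-bound : ∀ {N k m v} (A : Array N k v) → Assignment v k → IsLocating1 N k (suc m) v A →
  ∀ d → d + suc (suc m) ≡ k → v (suc (suc d)) < 2 * v (suc d) →
  product (map v (range (suc (suc d)) k)) + product (map v (range (suc (suc (suc d))) k)) ≤ N
suffix-nearlyEqual-bound {N} {m = m} {v} A σ loc d refl v₂<2v₁ = begin
  product (map v (range (suc (suc d)) (d + suc (suc m))))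
    + product (map v (range (suc (suc (suc d))) (d + suc (suc m))))
    ≡⟨ cong₂ (λ xs ys → product xs + product ys)
         (map-range≡alphabetSizes v (shift w) (suc d) (suc m) (sym (+-suc d (suc m))) (λ j → cong v (+-suc d j)))
         (map-range≡alphabetSizes v (shift (shift w)) (suc (suc d)) m
           (sym (trans (+-suc d (suc m)) (cong suc (+-suc d m))))
           (λ j → cong v (trans (+-suc d (suc j)) (cong suc (+-suc d j))))) ⟩
  product (alphabetSizes (shift w) (suc m)) + product (alphabetSizes (shift (shift w)) m)
    ≤⟨ nearlyEqual-bound m w (dropColumns d v A) (allFin N) (dropAssignment d v σ)
         (Covering-drop (allFin N) d v A σ cov) (Separating-drop (allFin N) d v A σ sep)
         (subst₂ (λ a b → v a < 2 * v b) (+-comm 2 d) (+-comm 1 d) v₂<2v₁) ⟩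
  length (allFin N)
    ≡⟨ length-tabulate {n = N} (λ r → r) ⟩
  N ∎
  where
  open ≤-Reasoning
  w = shiftBy d v
  cov = proj₁ (IsLocating1⇒allFin A loc)
  sep = proj₂ (IsLocating1⇒allFin A loc)

module SuffixBounds {N k : ℕ} {v : ℕ → ℕ} (A : Array N k v) (σ : Assignment v k) where

  product-last≤ : ∀ {t} → t < k → IsLocating1 N k t v A → product (map v (range (k ∸ t + 1) k)) ≤ N
  product-last≤ {t} t<k loc = subst (λ a → product (map v (range a k)) ≤ N) (+-comm 1 d) (*-cancelˡ-≤ 2 (begin
    2 * product xs             ≡⟨ cong (2 *_) (esym-length xs) ⟨
    2 * esym xs (length xs)    ≡⟨ cong (λ n → 2 * esym xs n) length-xs ⟩
    2 * esym xs t              ≤⟨ suffix-separating-bound A σ loc d t d+t≡k ⟩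
    N * (1 + t C t)            ≡⟨ cong (λ c → N * (1 + c)) (nCn≡1 t) ⟩
    N * 2                      ≡⟨ *-comm N 2 ⟩
    2 * N                      ∎))
    where
    open ≤-Reasoning
    d = k ∸ t
    d+t≡k : d + t ≡ k
    d+t≡k = m∸n+n≡m (<⇒≤ t<k)
    xs = map v (range (suc d) k)
    length-xs : length xs ≡ t
    length-xs = trans (cong length (map-range≡alphabetSizes v (shiftBy d v) d t d+t≡k (λ _ → refl)))
                      (length-alphabetSizes (shiftBy d v) t)

  ceilDiv-suffix≤ : ∀ {t} → t < k → IsLocating1 N k t v A → ∀ i → 1 ≤ i → i ≤ k ∸ t →
    ceilDiv (2 * esym (map v (range i k)) t) (1 + ((k ∸ i + 1) C t)) ≤ N
  ceilDiv-suffix≤ {t} t<k loc (suc d) _ 1+d≤k∸t = ceilDiv≤ _ _ N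
    (subst (λ n → 2 * esym (map v (range (suc d) k)) t ≤ N * (1 + n C t)) k∸d≡k∸[1+d]+1
      (suffix-separating-bound A σ loc d (k ∸ d) (m+[n∸m]≡n (<⇒≤ d<k))))
    where
    d<k : d < k
    d<k = ≤-trans 1+d≤k∸t (m∸n≤m k t)
    k∸d≡k∸[1+d]+1 : k ∸ d ≡ k ∸ suc d + 1
    k∸d≡k∸[1+d]+1 = trans (+-∸-assoc 1 d<k) (+-comm 1 (k ∸ suc d))

  ceilDiv-last≤ : ∀ {t} → t < k → IsLocating1 N k t v A →
    ceilDiv (2 * esym (map v (range (k ∸ t) k)) t) (2 + t) ≤ N
  ceilDiv-last≤ {t} t<k loc = ceilDiv≤ _ _ N
    (subst₂ (λ a n → 2 * esym (map v (range a k)) t ≤ N * (1 + n)) (sym (+-∸-assoc 1 t<k)) ([1+n]Cn≡1+n t)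
      (suffix-separating-bound A σ loc (k ∸ suc t) (suc t) (m∸n+n≡m t<k)))

  products-last≤ : ∀ {t} → t < k → IsLocating1 N k t v A → 1 ≤ t → v (k ∸ t + 1) < 2 * v (k ∸ t) →
    product (map v (range (k ∸ t + 1) k)) + product (map v (range (k ∸ t + 2) k)) ≤ N
  products-last≤ {suc m} t<k loc _ v₂<2v₁
    rewrite +-∸-assoc 1 t<k | +-comm (k ∸ suc (suc m)) 1 | +-comm (k ∸ suc (suc m)) 2 =
    suffix-nearlyEqual-bound A σ loc (k ∸ suc (suc m)) (m∸n+n≡m t<k) v₂<2v₁

  ceilDiv-lastTwo≤ : ∀ {t} → t < k → IsLocating1 N k t v A → t ≡ 1 →
    ceilDiv (2 * v (k ∸ 1) + 2 * v k) 3 ≤ N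
  ceilDiv-lastTwo≤ t<k loc refl = subst (λ a → ceilDiv a 3 ≤ N) 2*esym≡ (ceilDiv-last≤ t<k loc)
    where
    k∸1+1≡k : suc (k ∸ 1) ≡ k
    k∸1+1≡k = trans (+-comm 1 (k ∸ 1)) (m∸n+n≡m (<⇒≤ t<k))
    2*esym≡ : 2 * esym (map v (range (k ∸ 1) k)) 1 ≡ 2 * v (k ∸ 1) + 2 * v k
    2*esym≡ = begin
      2 * esym (map v (range (k ∸ 1) k)) 1
        ≡⟨ cong (λ b → 2 * esym (map v (range (k ∸ 1) b)) 1) k∸1+1≡k ⟨
      2 * esym (map v (range (k ∸ 1) (suc (k ∸ 1)))) 1
        ≡⟨ cong (2 *_) (esym-range-pair v (k ∸ 1)) ⟩
      2 * (v (k ∸ 1) + v (suc (k ∸ 1)))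
        ≡⟨ cong (λ b → 2 * (v (k ∸ 1) + v b)) k∸1+1≡k ⟩
      2 * (v (k ∸ 1) + v k)
        ≡⟨ *-distribˡ-+ 2 (v (k ∸ 1)) (v k) ⟩
      2 * v (k ∸ 1) + 2 * v k ∎
      where open ≡-Reasoning

-- Monotonicity of v and the case conditions are not needed: each bound holds for every locating
-- array; only the second half of case 3 uses v (k - t + 1) < 2 v (k - t).
theorem3p5 : (k t : ℕ) → 1 ≤ t → t < k → (v : ℕ → ℕ) →
    (∀ i → 1 ≤ i → i ≤ k → 2 ≤ v i) →
    (∀ i → 1 ≤ i → i < k → v i ≤ v (suc i)) →
    (N : ℕ) → (A : Array N k v) → IsLocating1 N k t v A →
    ((2 * v (k ∸ t) ≤ v (k ∸ t + 1) →
        product (map v (range (k ∸ t + 1) k)) ≤ N)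
    × (∀ i → 1 ≤ i → i ≤ k ∸ t →
        (∀ m → i ≤ m → m ≤ k ∸ t + 1 → v m ≡ v i) →
        ceilDiv (2 * esym (map v (range i k)) t) (1 + ((k ∸ i + 1) C t)) ≤ N)
    × (v (k ∸ t) < v (k ∸ t + 1) → v (k ∸ t + 1) < 2 * v (k ∸ t) → 2 ≤ t →
        (ceilDiv (2 * esym (map v (range (k ∸ t) k)) t) (2 + t)
          ⊔ (product (map v (range (k ∸ t + 1) k)) + product (map v (range (k ∸ t + 2) k)))) ≤ N)
    × (v (k ∸ t) < v (k ∸ t + 1) → v (k ∸ t + 1) < 2 * v (k ∸ t) → t ≡ 1 →
        ceilDiv (2 * v (k ∸ 1) + 2 * v k) 3 ≤ N))
theorem3p5 k t 1≤t t<k v 2≤v _ N A loc =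
  (λ _ → product-last≤ t<k loc) ,
  (λ i 1≤i i≤k∸t _ → ceilDiv-suffix≤ t<k loc i 1≤i i≤k∸t) ,
  (λ _ v₂<2v₁ _ → ⊔-lub (ceilDiv-last≤ t<k loc) (products-last≤ t<k loc 1≤t v₂<2v₁)) ,
  (λ _ _ t≡1 → ceilDiv-lastTwo≤ t<k loc t≡1)
  where open SuffixBounds {v = v} A (assignment 2≤v)
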